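{- Let $w$ be a finite word and $z\in\mathrm{Lyn}(w)$ with $|\mathrm{Sq}_w(z)|\ge1$. Let $r=\max\{i\ge1:\exists x\in[z],\ x^{2i}\in\mathrm{Sq}_w(z)\}$ and $s=|\{x\in[z]: x^{2r}\in\mathrm{Sq}_w(z)\}|$. Then $|\mathrm{Sq}_w(z)|=|z|(r-1)+s$ and $|\mathrm{CS}_w(z)|\ge 2|z|(r-1)+s+1$.
   Context: Fix a total order on letters and the induced lexicographic order. A square is a word $xx$ with $x$ non-empty; $\mathrm{Sq}(w)$ is the set of distinct squares that are factors of $w$. $F(w)$ is the set of factors of $w$ (including the empty word), $F_w(\ell)$ those of length $\ell$. For non-empty $z$, $[z]=\{z[i..|z|]z[1..i-1]:1\le i\le|z|\}$; for non-empty $x$ and $m\ge0$, $x^{m/|x|}$ is the length-$m$ prefix of $xxx\cdots$, and $[z]_m=\{x^{m/|x|}:x\in[z]\}$. A Lyndon word is a primitive word that is lexicographically smallest in its conjugacy class; $\mathrm{Lyn}(w)$ is the set of Lyndon factors of $w$. For $z\in\mathrm{Lyn}(w)$, $\mathrm{Sq}_w(z)=\{x^{2r}\in\mathrm{Sq}(w): x\in[z],\ r\ge1\}$. The Rauzy graph $\Gamma_w(\ell)$ is the directed multigraph with vertex set $F_w(\ell)$ and arc set $F_w(\ell+1)$, arc $u$ going from $u[1..\ell]$ to $u[2..\ell+1]$; $\Gamma_w$ is the disjoint union of $\Gamma_w(\ell)$, $0\le\ell\le|w|$. $\mathrm{CS}_w(z)$ is the set of circuits of $\Gamma_w$ whose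 arc set equals $[z]_m$ for some integer $m\ge|z|$ (one circuit for each such $m$ with $[z]_m\subseteq F(w)$; cyclic rotations are not distinguished). -}

module Defs where

open import Level using (0ℓ)
open import Data.Nat using (ℕ; _≤_; _*_)
open import Data.List using (List; []; _++_; concat; replicate; take; length)
open import Data.List.Membership.Propositional using (_∈_)
open import Data.List.Relation.Unary.Unique.Propositional using (Unique)
open import Data.List.Relation.Binary.Lex.Core using (Lex-≤)
open import Data.Product using (Σ; ∃; ∃-syntax; _×_)
open import Relation.Binary.Core using (Rel)
open import Relation.Binary.PropositionalEquality using (_≡_; _≢_)
open import Relation.Nullary using (¬_)
open import Function.Bundles using (_⇔_)

Word : Set → Set
Word A = List A

Card : {B : Set} → (B → Set) → ℕ → Set
Card {B} P n = Σ (List B) λ L → Unique L × (∀ u → (u ∈ L) ⇔ P u) × length L ≡ n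

IsMax : (ℕ → Set) → ℕ → Set
IsMax P r = P r × (∀ i → P i → i ≤ r)

module _ {A : Set} where

  Factor : Word A → Word A → Set
  Factor u w = ∃[ p ] ∃[ s ] w ≡ p ++ u ++ s

  pow : Word A → ℕ → Word A
  pow x n = concat (replicate n x)

  -- x^{m/|x|}: the length-m prefix of xxx... (for non-empty x)
  fracPow : Word A → ℕ → Word A
  fracPow x m = take m (pow x m)

  -- x ∈ [z]: x = z[i..|z|] z[1..i-1] for some 1 ≤ i ≤ |z|,
  -- i.e. z = u v with v non-empty and x = v u.
  Conj : Word A → Word A → Set
  Conj z x = ∃[ u ] ∃[ v ] (z ≡ u ++ v × v ≢ [] × x ≡ v ++ u)

  Primitive : Word A → Set
  Primitive z = z ≢ [] × ¬ (∃[ y ] ∃[ k ] (2 ≤ k × z ≡ pow y k))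

  Lyndon : Rel A 0ℓ → Word A → Set
  Lyndon _<_ z = Primitive z × (∀ x → Conj z x → Lex-≤ _≡_ _<_ z x)

  LynFactor : Rel A 0ℓ → Word A → Word A → Set
  LynFactor _<_ w z = Lyndon _<_ z × Factor z w

  SqW : Word A → Word A → Word A → Set
  SqW w z u = ∃[ x ] ∃[ r ] (Conj z x × 1 ≤ r × u ≡ pow x (2 * r) × Factor u w)

  SqExp : Word A → Word A → ℕ → Set
  SqExp w z i = 1 ≤ i × ∃[ x ] (Conj z x × SqW w z (pow x (2 * i)))

  TopConj : Word A → Word A → ℕ → Word A → Set
  TopConj w z r x = Conj z x × SqW w z (pow x (2 * r))

  -- CS_w(z): the circuits of Γ_w with arc set [z]_m, m ≥ |z|, [z]_m ⊆ F(w);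
  -- there is exactly one such circuit per such m, so the circuit is indexed by m.
  CS : Word A → Word A → ℕ → Set
  CS w z m = length z ≤ m × (∀ x → Conj z x → Factor (fracPow x m) w)

{-# OPTIONS --safe #-}
-- Let N = |z|. The conjugates of z are the length-N windows of the periodic word z z z ⋯, and
-- every (fractional) power of a conjugate is again a window. Since z is primitive, windows
-- starting less than N apart differ: equal ones would give z = uv = vu with u, v non-empty.
-- A conjugate y can be taken to start within N letters after a conjugate x, so y^q ⊑ x^q′
-- whenever q < q′. Taking for x a conjugate with x^2r ⊑ w, every y^2i with i < r occurs in w:
-- N(r − 1) squares below the top exponent, plus the s top ones. For the circuits take
-- m = N + t with t ≤ 2N(r − 1) + s and a conjugate starting at p: of the N − s + 1 conjugates
-- starting at p + s, …, p + N one is top, and the length-m window at p + N lies inside its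
-- 2r-th power.
module Submission where

open import Defs
open import Level using (0ℓ)
open import Data.Nat using (ℕ; zero; suc; _+_; _*_; _∸_; _≤_; _<_; _≤?_; z≤n; s≤s; s≤s⁻¹; z<s; allUpTo?)
open import Data.Nat.Properties
open import Data.Nat.DivMod using (_%_; m%n<n; [m+kn]%n≡m%n; m<n⇒m%n≡m; %-distribˡ-+; m%n%n≡m%n)
open import Data.Nat.Induction using (<-wellFounded)
open import Data.Nat.Tactic.RingSolver using (solve-∀)
open import Induction.WellFounded using (Acc; acc)
open import Data.List using (List; []; _∷_; _++_; map; length; take; drop; applyUpTo; upTo; filter; cartesianProduct)
open import Data.List.Properties
  using (≡-dec; length-++; length-map; length-upTo; length-applyUpTo; length-take; length-drop; ++-assoc;
         ++-identityʳ; ++-cancelˡ; ∷-injectiveˡ; ∷-injectiveʳ; take++drop≡id)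
open import Data.List.Membership.Propositional using (_∈_; find; lose)
open import Data.List.Membership.Propositional.Properties
  using (∈-∃++; ∈-++⁺ˡ; ∈-++⁺ʳ; ∈-++⁻; ∈-map⁺; ∈-map⁻; ∈-upTo⁺; ∈-upTo⁻; ∈-filter⁺; ∈-filter⁻;
         ∈-cartesianProduct⁺; ∈-cartesianProduct⁻; ∈-applyUpTo⁺; ∈-applyUpTo⁻)
import Data.List.Membership.DecPropositional as DecMem
open import Data.List.Relation.Binary.Infix.Heterogeneous using (Infix; MkView; toView; fromView)
open import Data.List.Relation.Binary.Infix.Heterogeneous.Properties using (infix?)
open import Data.List.Relation.Binary.Pointwise using (Pointwise-≡⇒≡; ≡⇒Pointwise-≡)
open import Data.List.Relation.Unary.All as All using (All; []; _∷_)
import Data.List.Relation.Unary.All.Properties as All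
open import Data.List.Relation.Unary.Any using (here; there; any?)
open import Data.List.Relation.Unary.Unique.Propositional using (Unique; []; _∷_)
import Data.List.Relation.Unary.Unique.Propositional.Properties as Unique
open import Data.Product using (∃-syntax; _×_; _,_; proj₁; proj₂)
open import Data.Sum using (_⊎_; inj₁; inj₂)
open import Data.Empty using (⊥; ⊥-elim)
open import Function using (_⇔_; mk⇔; Equivalence)
open import Function.Construct.Composition using (_⇔-∘_)
open import Relation.Nullary using (Dec; yes; no)
open import Relation.Nullary.Decidable using (map′; _×-dec_)
open import Relation.Unary using (Decidable)
open import Relation.Binary.Core using (Rel)
open import Relation.Binary.Structures using (IsStrictTotalOrder)
open import Relation.Binary.Definitions using (DecidableEquality)
open import Relation.Binary.PropositionalEquality

private variable
  A B C : Set
  P Q : B → Set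
  d : A
  f g : ℕ → A
  u v x y : List A
  c i j k m n p q : ℕ

Image : (B → C) → (B → Set) → C → Set
Image f P u = ∃[ x ] (P x × u ≡ f x)

Unique-length-mono : {xs ys : List B} → Unique xs → (∀ {x} → x ∈ xs → x ∈ ys) → length xs ≤ length ys
Unique-length-mono {xs = []} _ _ = z≤n
Unique-length-mono {xs = x ∷ xs} (x∉xs ∷ uxs) xs⊆ys with ∈-∃++ (xs⊆ys (here refl))
... | us , vs , refl = subst (suc (length xs) ≤_) (length-removed us) (s≤s (Unique-length-mono uxs xs⊆us++vs))
  where
  length-removed : ∀ us → suc (length (us ++ vs)) ≡ length (us ++ x ∷ vs)
  length-removed [] = refl
  length-removed (_ ∷ us) = cong suc (length-removed us)
  xs⊆us++vs : ∀ {y} → y ∈ xs → y ∈ us ++ vs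
  xs⊆us++vs y∈xs with ∈-++⁻ us (xs⊆ys (there y∈xs))
  ... | inj₁ y∈us = ∈-++⁺ˡ y∈us
  ... | inj₂ (here refl) = ⊥-elim (All.lookup x∉xs y∈xs refl)
  ... | inj₂ (there y∈vs) = ∈-++⁺ʳ us y∈vs

Unique-map⁺ : {f : B → C} {xs : List B} → (∀ {x y} → x ∈ xs → y ∈ xs → f x ≡ f y → x ≡ y) →
              Unique xs → Unique (map f xs)
Unique-map⁺ _ [] = []
Unique-map⁺ f-inj (x∉xs ∷ uxs) =
  All.map⁺ (All.tabulate λ y∈xs fx≡fy → All.lookup x∉xs y∈xs (f-inj (here refl) (there y∈xs) fx≡fy))
  ∷ Unique-map⁺ (λ x∈ y∈ → f-inj (there x∈) (there y∈)) uxs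

Card-unique : Card P m → Card P n → m ≡ n
Card-unique (L , uL , L⇔P , refl) (L′ , uL′ , L′⇔P , refl) = ≤-antisym
  (Unique-length-mono uL (λ x∈L → Equivalence.from (L′⇔P _) (Equivalence.to (L⇔P _) x∈L)))
  (Unique-length-mono uL′ (λ x∈L′ → Equivalence.from (L⇔P _) (Equivalence.to (L′⇔P _) x∈L′)))

Card-cong : (∀ u → P u ⇔ Q u) → Card P n → Card Q n
Card-cong P⇔Q (L , uL , L⇔P , len) = L , uL , (λ u → P⇔Q u ⇔-∘ L⇔P u) , len

Card⇒length≤ : {xs : List B} → Card P c → Unique xs → All P xs → length xs ≤ c
Card⇒length≤ (L , _ , L⇔P , refl) uxs Pxs =
  Unique-length-mono uxs (λ x∈xs → Equivalence.from (L⇔P _) (All.lookup Pxs x∈xs))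

Card-upTo : Card (_< n) n
Card-upTo {n} = upTo n , Unique.upTo⁺ n , (λ _ → mk⇔ ∈-upTo⁻ ∈-upTo⁺) , length-upTo n

Card-⊎ : (∀ {u} → P u → Q u → ⊥) → Card P m → Card Q n → Card (λ u → P u ⊎ Q u) (m + n)
Card-⊎ {P = P} {Q = Q} P∩Q=∅ (L , uL , L⇔P , refl) (L′ , uL′ , L′⇔Q , refl) =
  L ++ L′ ,
  Unique.++⁺ uL uL′ (λ (u∈L , u∈L′) → P∩Q=∅ (Equivalence.to (L⇔P _) u∈L) (Equivalence.to (L′⇔Q _) u∈L′)) ,
  (λ u → mk⇔ (to u) (from u)) ,
  length-++ L
  where
  to : ∀ u → u ∈ L ++ L′ → P u ⊎ Q u
  to u u∈ with ∈-++⁻ L u∈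
  ... | inj₁ u∈L = inj₁ (Equivalence.to (L⇔P u) u∈L)
  ... | inj₂ u∈L′ = inj₂ (Equivalence.to (L′⇔Q u) u∈L′)
  from : ∀ u → P u ⊎ Q u → u ∈ L ++ L′
  from u (inj₁ Pu) = ∈-++⁺ˡ (Equivalence.from (L⇔P u) Pu)
  from u (inj₂ Qu) = ∈-++⁺ʳ L (Equivalence.from (L′⇔Q u) Qu)

length-cartesianProduct : (xs : List B) (ys : List C) →
                          length (cartesianProduct xs ys) ≡ length xs * length ys
length-cartesianProduct [] ys = refl
length-cartesianProduct (x ∷ xs) ys =
  trans (length-++ (map (x ,_) ys)) (cong₂ _+_ (length-map (x ,_) ys) (length-cartesianProduct xs ys))

Card-× : {P : B → Set} {Q : C → Set} → Card P m → Card Q n → Card (λ (x , y) → P x × Q y) (m * n)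
Card-× (L , uL , L⇔P , refl) (L′ , uL′ , L′⇔Q , refl) =
  cartesianProduct L L′ ,
  Unique.cartesianProduct⁺ uL uL′ ,
  (λ (x , y) → mk⇔ (λ xy∈ → let x∈L , y∈L′ = ∈-cartesianProduct⁻ L L′ xy∈
                             in Equivalence.to (L⇔P x) x∈L , Equivalence.to (L′⇔Q y) y∈L′)
                    (λ (Px , Qy) → ∈-cartesianProduct⁺ (Equivalence.from (L⇔P x) Px)
                                                       (Equivalence.from (L′⇔Q y) Qy))) ,
  length-cartesianProduct L L′

Card-image : {f : B → C} → (∀ {x y} → P x → P y → f x ≡ f y → x ≡ y) → Card P n → Card (Image f P) n
Card-image {f = f} f-inj (L , uL , L⇔P , refl) =
  map f L ,
  Unique-map⁺ (λ x∈L y∈L → f-inj (Equivalence.to (L⇔P _) x∈L) (Equivalence.to (L⇔P _) y∈L)) uL ,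
  (λ u → mk⇔ (λ u∈ → let x , x∈L , u≡fx = ∈-map⁻ f u∈ in x , Equivalence.to (L⇔P x) x∈L , u≡fx)
             (λ { (x , Px , refl) → ∈-map⁺ f (Equivalence.from (L⇔P x) Px) })) ,
  length-map f L

Card-bounded : {P : ℕ → Set} → Decidable P → (∀ {m} → P m → m < n) → ∃[ c ] Card P c
Card-bounded {n} P? P<n =
  _ , filter P? (upTo n) , Unique.filter⁺ P? (Unique.upTo⁺ n) ,
  (λ m → mk⇔ (λ m∈ → proj₂ (∈-filter⁻ P? {xs = upTo n} m∈)) (λ Pm → ∈-filter⁺ P? (∈-upTo⁺ (P<n Pm)) Pm)) , refl

Card-mono : Card P m → Card Q n → (∀ {x} → P x → Q x) → m ≤ n
Card-mono (L , uL , L⇔P , refl) cardQ P⊆Q =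
  Card⇒length≤ cardQ uL (All.tabulate (λ x∈L → P⊆Q (Equivalence.to (L⇔P _) x∈L)))

Card-meets : DecidableEquality B → {U : B → Set} → Card U c → Card P m → (∀ {x} → P x → U x) →
             {ys : List B} → Unique ys → All U ys → c < m + length ys → ∃[ y ] (y ∈ ys × P y)
Card-meets _≟_ cardU (L , uL , L⇔P , refl) P⊆U {ys} uys Uys c<m+|ys|
  with any? (λ y → DecMem._∈?_ _≟_ y L) ys
... | yes meets = let y , y∈ys , y∈L = find meets in y , y∈ys , Equivalence.to (L⇔P y) y∈L
... | no disjoint = ⊥-elim (<⇒≱ c<m+|ys| (subst (_≤ _) (length-++ L)
        (Card⇒length≤ cardU (Unique.++⁺ uL uys (λ (y∈L , y∈ys) → disjoint (lose y∈ys y∈L)))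
                             (All.++⁺ (All.tabulate (λ y∈L → P⊆U (Equivalence.to (L⇔P _) y∈L))) Uys))))

at : A → List A → ℕ → A
at d [] i = d
at d (x ∷ u) zero = x
at d (x ∷ u) (suc i) = at d u i

at-++ˡ : ∀ u → i < length u → at d (u ++ v) i ≡ at d u i
at-++ˡ {i = zero} (x ∷ u) _ = refl
at-++ˡ {i = suc i} (x ∷ u) (s≤s i<|u|) = at-++ˡ u i<|u|

at-++ʳ : ∀ u → at d (u ++ v) (length u + i) ≡ at d v i
at-++ʳ [] = refl
at-++ʳ (x ∷ u) = at-++ʳ u

applyUpTo-at : ∀ u → applyUpTo (at d u) (length u) ≡ u
applyUpTo-at [] = refl
applyUpTo-at (x ∷ u) = cong (x ∷_) (applyUpTo-at u)

applyUpTo-cong : ∀ m → (∀ {i} → i < m → f i ≡ g i) → applyUpTo f m ≡ applyUpTo g m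
applyUpTo-cong zero f≡g = refl
applyUpTo-cong (suc m) f≡g = cong₂ _∷_ (f≡g (s≤s z≤n)) (applyUpTo-cong m (λ i<m → f≡g (s≤s i<m)))

applyUpTo-injective : ∀ m → applyUpTo f m ≡ applyUpTo g m → i < m → f i ≡ g i
applyUpTo-injective {i = zero} (suc m) eq _ = ∷-injectiveˡ eq
applyUpTo-injective {i = suc i} (suc m) eq (s≤s i<m) = applyUpTo-injective m (∷-injectiveʳ eq) i<m

applyUpTo-++ : ∀ (f : ℕ → A) m n → applyUpTo f (m + n) ≡ applyUpTo f m ++ applyUpTo (λ i → f (m + i)) n
applyUpTo-++ f zero n = refl
applyUpTo-++ f (suc m) n = cong (f 0 ∷_) (applyUpTo-++ (λ i → f (suc i)) m n)

take-applyUpTo : ∀ (f : ℕ → A) {m n} → m ≤ n → take m (applyUpTo f n) ≡ applyUpTo f m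
take-applyUpTo f z≤n = refl
take-applyUpTo f (s≤s m≤n) = cong (f 0 ∷_) (take-applyUpTo (λ i → f (suc i)) m≤n)

take-length-++ : ∀ u → take (length u) (u ++ v) ≡ u
take-length-++ [] = refl
take-length-++ (x ∷ u) = cong (x ∷_) (take-length-++ u)

length-pow : ∀ x q → length (pow {A} x q) ≡ q * length x
length-pow x zero = refl
length-pow x (suc q) = trans (length-++ x) (cong (length x +_) (length-pow x q))

pow-+ : ∀ x m n → pow {A} x (m + n) ≡ pow x m ++ pow x n
pow-+ x zero n = refl
pow-+ x (suc m) n = trans (cong (x ++_) (pow-+ x m n)) (sym (++-assoc x (pow x m) (pow x n)))

pow-injective : ∀ q → 0 < q → length x ≡ length y → pow x q ≡ pow y q → x ≡ y
pow-injective {x = x} {y = y} q@(suc _) _ |x|≡|y| xᵠ≡yᵠ = begin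
  x                         ≡⟨ take-length-++ x ⟨
  take (length x) (pow x q) ≡⟨ cong₂ take |x|≡|y| xᵠ≡yᵠ ⟩
  take (length y) (pow y q) ≡⟨ take-length-++ y ⟩
  y                         ∎
  where open ≡-Reasoning

Conj-length : Conj u x → length x ≡ length u
Conj-length (u₁ , u₂ , refl , _ , refl) =
  trans (length-++ u₂) (trans (+-comm (length u₂) (length u₁)) (sym (length-++ u₁)))

Factor-trans : Factor u v → Factor v x → Factor u x
Factor-trans {u = u} (p , s , refl) (p′ , s′ , refl) = p′ ++ p , s ++ s′ , (begin
  p′ ++ (p ++ u ++ s) ++ s′ ≡⟨ cong (p′ ++_) (++-assoc p (u ++ s) s′) ⟩
  p′ ++ p ++ (u ++ s) ++ s′ ≡⟨ cong (λ t → p′ ++ p ++ t) (++-assoc u s s′) ⟩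
  p′ ++ p ++ u ++ s ++ s′   ≡⟨ ++-assoc p′ p (u ++ s ++ s′) ⟨
  (p′ ++ p) ++ u ++ s ++ s′ ∎)
  where open ≡-Reasoning

Factor-length : Factor u v → length u ≤ length v
Factor-length {u = u} (p , s , refl) = begin
  length u                    ≤⟨ m≤m+n (length u) (length s) ⟩
  length u + length s         ≡⟨ length-++ u ⟨
  length (u ++ s)             ≤⟨ m≤n+m _ (length p) ⟩
  length p + length (u ++ s)  ≡⟨ length-++ p ⟨
  length (p ++ u ++ s)        ∎
  where open ≤-Reasoning

Factor? : DecidableEquality A → ∀ u v → Dec (Factor u v)
Factor? _≟_ u v = map′ Infix⇒Factor Factor⇒Infix (infix? _≟_ u v)
  where
  Infix⇒Factor : Infix _≡_ u v → Factor u v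
  Infix⇒Factor u⊑v with MkView p eq s ← toView u⊑v =
    p , s , cong (λ t → p ++ t ++ s) (sym (Pointwise-≡⇒≡ eq))
  Factor⇒Infix : Factor u v → Infix _≡_ u v
  Factor⇒Infix (p , s , refl) = fromView (MkView p (≡⇒Pointwise-≡ refl) s)

++-prefix : ∀ u → u ++ x ≡ v ++ y → length u ≤ length v → ∃[ d ] v ≡ u ++ d
++-prefix {v = v} [] _ _ = v , refl
++-prefix {v = b ∷ v} (a ∷ u) eq (s≤s |u|≤|v|) with ++-prefix {v = v} u (∷-injectiveʳ eq) |u|≤|v|
... | d , refl = d , cong (_∷ u ++ d) (sym (∷-injectiveˡ eq))

commute⇒pow : ∀ u v → u ++ v ≡ v ++ u → ∃[ t ] ∃[ a ] ∃[ b ] (u ≡ pow {A} t a × v ≡ pow t b)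
commute⇒pow u v = go u v (<-wellFounded (length u + length v))
  where
  go : ∀ u v → Acc _<_ (length u + length v) → u ++ v ≡ v ++ u →
       ∃[ t ] ∃[ a ] ∃[ b ] (u ≡ pow t a × v ≡ pow t b)
  go [] v _ _ = v , 0 , 1 , refl , sym (++-identityʳ v)
  go u@(_ ∷ _) [] _ _ = u , 1 , 0 , sym (++-identityʳ u) , refl
  go u@(_ ∷ _) v@(_ ∷ _) (acc rec) uv≡vu with ≤-total (length u) (length v)
  ... | inj₁ |u|≤|v| with ++-prefix {v = v} u uv≡vu |u|≤|v|
  ...   | d , refl with go u d (rec shorter) (++-cancelˡ u _ _ (trans uv≡vu (++-assoc u d u)))
    where
    shorter : length u + length d < length u + length (u ++ d)
    shorter = +-monoʳ-< (length u) (subst (length d <_) (sym (length-++ u)) (m<n+m (length d) z<s))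
  ...     | t , a , b , u≡tᵃ , d≡tᵇ = t , a , a + b , u≡tᵃ , trans (cong₂ _++_ u≡tᵃ d≡tᵇ) (sym (pow-+ t a b))
  go u@(_ ∷ _) v@(_ ∷ _) (acc rec) uv≡vu | inj₂ |v|≤|u| with ++-prefix {v = u} v (sym uv≡vu) |v|≤|u|
  ...   | d , refl with go d v (rec shorter) (++-cancelˡ v _ _ (trans (sym (++-assoc v d v)) uv≡vu))
    where
    shorter : length d + length v < length (v ++ d) + length v
    shorter = +-monoˡ-< (length v) (subst (length d <_) (sym (length-++ v)) (m<n+m (length d) z<s))
  ...     | t , a , b , d≡tᵃ , v≡tᵇ = t , b + a , b , trans (cong₂ _++_ v≡tᵇ d≡tᵃ) (sym (pow-+ t b a)) , v≡tᵇ

Primitive⇒¬commute : Primitive (u ++ v) → u ≢ [] → v ≢ [] → u ++ v ≢ v ++ u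
Primitive⇒¬commute {u = u} {v = v} (_ , no-root) u≢[] v≢[] uv≡vu
  with commute⇒pow u v uv≡vu
... | t , zero , _ , refl , _ = u≢[] refl
... | t , _ , zero , _ , refl = v≢[] refl
... | t , suc a , suc b , refl , refl =
  no-root (t , suc a + suc b , +-mono-≤ (s≤s z≤n) (s≤s z≤n) , sym (pow-+ t (suc a) (suc b)))

Periodic : ℕ → (ℕ → A) → Set
Periodic p f = ∀ i → f (p + i) ≡ f i

window : (ℕ → A) → ℕ → ℕ → List A
window f k m = applyUpTo (λ i → f (k + i)) m

length-window : ∀ (f : ℕ → A) k m → length (window f k m) ≡ m
length-window f k m = length-applyUpTo _ m

take-window : ∀ (f : ℕ → A) k → m ≤ n → take m (window f k n) ≡ window f k m
take-window f k = take-applyUpTo (λ i → f (k + i))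

window-++ : ∀ (f : ℕ → A) k m n → window f k (m + n) ≡ window f k m ++ window f (k + m) n
window-++ f k m n = trans (applyUpTo-++ (λ i → f (k + i)) m n)
  (cong (window f k m ++_) (applyUpTo-cong n (λ {i} _ → cong f (sym (+-assoc k m i)))))

window-shift : Periodic p f → ∀ k m → window f (k + p) m ≡ window f k m
window-shift {p = p} {f = f} per k m = applyUpTo-cong m λ {i} _ → begin
  f (k + p + i)   ≡⟨ cong f (trans (cong (_+ i) (+-comm k p)) (+-assoc p k i)) ⟩
  f (p + (k + i)) ≡⟨ per (k + i) ⟩
  f (k + i)       ∎
  where open ≡-Reasoning

window-pow : Periodic p f → ∀ k q → pow (window f k p) q ≡ window f k (q * p)
window-pow per k zero = refl
window-pow {p = p} {f = f} per k (suc q) = begin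
  window f k p ++ pow (window f k p) q     ≡⟨ cong (window f k p ++_) (window-pow per k q) ⟩
  window f k p ++ window f k (q * p)       ≡⟨ cong (window f k p ++_) (window-shift per k (q * p)) ⟨
  window f k p ++ window f (k + p) (q * p) ≡⟨ window-++ f k p (q * p) ⟨
  window f k (p + q * p)                   ∎
  where open ≡-Reasoning

window-factor : ∀ (f : ℕ → A) → j ≤ k → k + m ≤ j + n → Factor (window f k m) (window f j n)
window-factor {j = j} {k = k} {m = m} {n = n} f j≤k k+m≤j+n =
  window f j (k ∸ j) , window f (k + m) e , (begin
    window f j n                                          ≡⟨ cong (window f j) n-split ⟩
    window f j ((k ∸ j) + (m + e))                        ≡⟨ window-++ f j (k ∸ j) (m + e) ⟩
    window f j (k ∸ j) ++ window f (j + (k ∸ j)) (m + e)  ≡⟨ cong (λ t → window f j (k ∸ j) ++ window f t (m + e)) (m+[n∸m]≡n j≤k) ⟩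
    window f j (k ∸ j) ++ window f k (m + e)              ≡⟨ cong (window f j (k ∸ j) ++_) (window-++ f k m e) ⟩
    window f j (k ∸ j) ++ window f k m ++ window f (k + m) e ∎)
  where
  open ≡-Reasoning
  e : ℕ
  e = j + n ∸ (k + m)
  n-split : n ≡ (k ∸ j) + (m + e)
  n-split = +-cancelˡ-≡ j n ((k ∸ j) + (m + e)) (begin
    j + n                   ≡⟨ m+[n∸m]≡n k+m≤j+n ⟨
    k + m + e               ≡⟨ +-assoc k m e ⟩
    k + (m + e)             ≡⟨ cong (_+ (m + e)) (m+[n∸m]≡n j≤k) ⟨
    j + (k ∸ j) + (m + e)   ≡⟨ +-assoc j (k ∸ j) (m + e) ⟩
    j + ((k ∸ j) + (m + e)) ∎)

window-injective : ∀ (f : ℕ → A) k l m → window f k m ≡ window f l m → i < m → f (k + i) ≡ f (l + i)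
window-injective f k l m = applyUpTo-injective {f = λ i → f (k + i)} {g = λ i → f (l + i)} m

module Conjugates {A : Set} (a : A) (z′ : List A) where

  z : List A
  z = a ∷ z′

  N : ℕ
  N = length z

  -- letter is the periodic word z z z ⋯, and rot k the conjugate of z starting at position k.
  letter : ℕ → A
  letter i = at a z (i % N)

  letter-+* : ∀ q i → letter (q * N + i) ≡ letter i
  letter-+* q i = cong (at a z) (trans (cong (_% N) (+-comm (q * N) i)) ([m+kn]%n≡m%n i q N))

  letter-periodic : Periodic N letter
  letter-periodic i = trans (cong (λ t → letter (t + i)) (sym (*-identityˡ N))) (letter-+* 1 i)

  letter-below : ∀ {i} → i < N → letter i ≡ at a z i
  letter-below i<N = cong (at a z) (m<n⇒m%n≡m i<N)

  rot : ℕ → List A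
  rot k = window letter k N

  rot-split : ∀ u {v} → z ≡ u ++ v → rot (length u) ≡ v ++ u
  rot-split u {v} z≡uv = begin
    window letter (length u) N                                        ≡⟨ cong (window letter (length u)) N≡ ⟩
    window letter (length u) (length v + length u)                    ≡⟨ window-++ letter (length u) (length v) (length u) ⟩
    window letter (length u) (length v) ++ window letter (length u + length v) (length u) ≡⟨ cong₂ _++_ v-part u-part ⟩
    v ++ u                                                            ∎
    where
    open ≡-Reasoning
    N≡u+v : N ≡ length u + length v
    N≡u+v = trans (cong length z≡uv) (length-++ u)
    N≡ : N ≡ length v + length u
    N≡ = trans N≡u+v (+-comm (length u) (length v))
    v-part : window letter (length u) (length v) ≡ v
    v-part = trans (applyUpTo-cong (length v) λ {i} i<|v| → begin
      letter (length u + i)         ≡⟨ letter-below (subst (length u + i <_) (sym N≡u+v) (+-monoʳ-< (length u) i<|v|)) ⟩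
      at a z (length u + i)         ≡⟨ cong (λ t → at a t (length u + i)) z≡uv ⟩
      at a (u ++ v) (length u + i)  ≡⟨ at-++ʳ u ⟩
      at a v i                      ∎) (applyUpTo-at v)
    u-part : window letter (length u + length v) (length u) ≡ u
    u-part = trans (applyUpTo-cong (length u) λ {i} i<|u| → begin
      letter (length u + length v + i) ≡⟨ cong (λ t → letter (t + i)) N≡u+v ⟨
      letter (N + i)                   ≡⟨ letter-periodic i ⟩
      letter i                         ≡⟨ letter-below (<-≤-trans i<|u| (subst (length u ≤_) (sym N≡u+v) (m≤m+n _ _))) ⟩
      at a z i                         ≡⟨ cong (λ t → at a t i) z≡uv ⟩
      at a (u ++ v) i                  ≡⟨ at-++ˡ u i<|u| ⟩
      at a u i                         ∎) (applyUpTo-at u)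

  rot-zero : rot 0 ≡ z
  rot-zero = trans (rot-split [] refl) (++-identityʳ z)

  length-take-≤ : ∀ {k} → k ≤ N → length (take k z) ≡ k
  length-take-≤ {k} k≤N = trans (length-take k z) (m≤n⇒m⊓n≡m k≤N)

  rot-take-drop : ∀ {k} → k ≤ N → rot k ≡ drop k z ++ take k z
  rot-take-drop {k} k≤N =
    subst (λ i → rot i ≡ drop k z ++ take k z) (length-take-≤ k≤N) (rot-split (take k z) (sym (take++drop≡id k z)))

  drop-nonempty : ∀ {k} → k < N → drop k z ≢ []
  drop-nonempty {k} k<N drop≡[] = <⇒≢ (m<n⇒0<n∸m k<N) (sym (trans (sym (length-drop k z)) (cong length drop≡[])))

  rot-Conj : ∀ k → Conj z (rot k)
  rot-Conj k = subst (Conj z) (sym rot-%) (take k′ z , drop k′ z , sym (take++drop≡id k′ z) ,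
                                            drop-nonempty (m%n<n k N) , rot-take-drop (<⇒≤ (m%n<n k N)))
    where
    k′ : ℕ
    k′ = k % N
    rot-% : rot k ≡ rot k′
    rot-% = applyUpTo-cong N λ {i} _ → cong (at a z) (begin
      (k + i) % N                ≡⟨ %-distribˡ-+ k i N ⟩
      (k % N + i % N) % N        ≡⟨ cong (λ t → (t + i % N) % N) (m%n%n≡m%n k N) ⟨
      (k % N % N + i % N) % N    ≡⟨ %-distribˡ-+ (k % N) i N ⟨
      (k′ + i) % N               ∎)
      where open ≡-Reasoning

  Conj⇒rot : ∀ {x} → Conj z x → ∃[ k ] (k < N × x ≡ rot k)
  Conj⇒rot (u , [] , _ , []≢[] , _) = ⊥-elim ([]≢[] refl)
  Conj⇒rot (u , v@(_ ∷ _) , z≡uv , _ , refl) = length u , |u|<N , sym (rot-split u z≡uv)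
    where
    |u|<N : length u < N
    |u|<N = subst (length u <_) (sym (trans (cong length z≡uv) (length-++ u))) (m<m+n (length u) z<s)

  pow-rot : ∀ k q → pow (rot k) q ≡ window letter k (q * N)
  pow-rot = window-pow letter-periodic

  fracPow-rot : ∀ k m → fracPow (rot k) m ≡ window letter k m
  fracPow-rot k m = trans (cong (take m) (pow-rot k m)) (take-window letter k (m≤m*n m N))

  Conj-pow-factor : ∀ {x y q q′} → Conj z x → Conj z y → q < q′ → Factor (pow y q) (pow x q′)
  Conj-pow-factor {q = q} {q′} cx cy q<q′ with Conj⇒rot cx | Conj⇒rot cy
  ... | j , j<N , refl | k , k<N , refl =
    subst₂ Factor (sym (pow-rot k q)) (sym (pow-rot j q′)) (window-factor-rot (≤-total j k))
    where
    fits : ∀ {k′} → k′ ≤ j + N → k′ + q * N ≤ j + q′ * N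
    fits {k′} k′≤j+N = begin
      k′ + q * N        ≤⟨ +-monoˡ-≤ (q * N) k′≤j+N ⟩
      j + N + q * N     ≡⟨ +-assoc j N (q * N) ⟩
      j + suc q * N     ≤⟨ +-monoʳ-≤ j (*-monoˡ-≤ N q<q′) ⟩
      j + q′ * N        ∎
      where open ≤-Reasoning
    window-factor-rot : j ≤ k ⊎ k ≤ j → Factor (window letter k (q * N)) (window letter j (q′ * N))
    window-factor-rot (inj₁ j≤k) = window-factor letter j≤k (fits (≤-trans (<⇒≤ k<N) (m≤n+m N j)))
    window-factor-rot (inj₂ k≤j) = subst (λ t → Factor t _) (window-shift letter-periodic k (q * N))
      (window-factor letter (≤-trans (<⇒≤ j<N) (m≤n+m N k)) (fits (+-monoˡ-≤ N k≤j)))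

  module _ (prim : Primitive z) where

    rot-aperiodic : ∀ {j d} → 0 < d → d < N → rot j ≢ rot (j + d)
    rot-aperiodic {j} {d} 0<d d<N rotʲ≡rotʲ⁺ᵈ =
      Primitive⇒¬commute (subst Primitive (sym (take++drop≡id d z)) prim) pre≢[] (drop-nonempty d<N) pre-suf-commute
      where
      pre suf : List A
      pre = take d z
      suf = drop d z
      pre≢[] : pre ≢ []
      pre≢[] pre≡[] = <⇒≢ 0<d (trans (sym (cong length pre≡[])) (length-take-≤ (<⇒≤ d<N)))
      -- Comparing the powers pow (rot _) (suc i) extends the equality beyond the first N letters.
      shifted : ∀ i → letter (j + i) ≡ letter (j + d + i)
      shifted i = window-injective letter j (j + d) (suc i * N)
        (trans (sym (pow-rot j (suc i))) (trans (cong (λ x → pow x (suc i)) rotʲ≡rotʲ⁺ᵈ) (pow-rot (j + d) (suc i))))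
        (m≤m*n (suc i) N)
      period-d : ∀ i → letter i ≡ letter (d + i)
      period-d i = begin
        letter i                              ≡⟨ letter-+* j i ⟨
        letter (j * N + i)                    ≡⟨ cong letter (m*[1+n]+o≡m+[m*n+o] j (length z′) i) ⟩
        letter (j + (j * length z′ + i))      ≡⟨ shifted (j * length z′ + i) ⟩
        letter (j + d + (j * length z′ + i))  ≡⟨ cong letter (m+d+[m*n+o]≡m*[1+n]+[d+o] j d (length z′) i) ⟩
        letter (j * N + (d + i))              ≡⟨ letter-+* j (d + i) ⟩
        letter (d + i)                        ∎
        where
        open ≡-Reasoning
        m*[1+n]+o≡m+[m*n+o] : ∀ m n o → m * suc n + o ≡ m + (m * n + o)
        m*[1+n]+o≡m+[m*n+o] = solve-∀
        m+d+[m*n+o]≡m*[1+n]+[d+o] : ∀ m d n o → m + d + (m * n + o) ≡ m * suc n + (d + o)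
        m+d+[m*n+o]≡m*[1+n]+[d+o] = solve-∀
      pre-suf-commute : pre ++ suf ≡ suf ++ pre
      pre-suf-commute = begin
        pre ++ suf ≡⟨ take++drop≡id d z ⟩
        z          ≡⟨ rot-zero ⟨
        rot 0      ≡⟨ applyUpTo-cong N (λ {i} _ → period-d i) ⟩
        rot d      ≡⟨ rot-take-drop (<⇒≤ d<N) ⟩
        suf ++ pre ∎
        where open ≡-Reasoning

    rot-distinct : ∀ {i j} → i < j → j < i + N → rot i ≢ rot j
    rot-distinct {i} {j} i<j j<i+N = subst (λ t → rot i ≢ rot t) (m+[n∸m]≡n (<⇒≤ i<j))
      (rot-aperiodic {j = i} (m<n⇒0<n∸m i<j) (+-cancelˡ-< i (j ∸ i) N (subst (_< i + N) (sym (m+[n∸m]≡n (<⇒≤ i<j))) j<i+N)))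

    Card-Conj : Card (Conj z) N
    Card-Conj = applyUpTo rot N ,
      Unique.applyUpTo⁺₁ rot N (λ i<j j<N → rot-distinct i<j (<-≤-trans j<N (m≤n+m N _))) ,
      (λ x → mk⇔ (λ x∈ → let k , _ , x≡rotᵏ = ∈-applyUpTo⁻ rot x∈ in subst (Conj z) (sym x≡rotᵏ) (rot-Conj k))
                 (λ cx → let k , k<N , x≡rotᵏ = Conj⇒rot cx in subst (_∈ applyUpTo rot N) (sym x≡rotᵏ) (∈-applyUpTo⁺ rot k<N))) ,
      length-applyUpTo rot N

  SqW⇒Factor : ∀ {w u} → SqW w z u → Factor u w
  SqW⇒Factor (_ , _ , _ , _ , refl , u⊑w) = u⊑w

  Conj-pow-exponent : ∀ {x y} q q′ → Conj z x → Conj z y → pow x q ≡ pow y q′ → q ≡ q′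
  Conj-pow-exponent {x} {y} q q′ cx cy xᵠ≡yᵠ′ = *-cancelʳ-≡ q q′ N (begin
    q * N             ≡⟨ cong (q *_) (Conj-length cx) ⟨
    q * length x      ≡⟨ length-pow x q ⟨
    length (pow x q)  ≡⟨ cong length xᵠ≡yᵠ′ ⟩
    length (pow y q′) ≡⟨ length-pow y q′ ⟩
    q′ * length y     ≡⟨ cong (q′ *_) (Conj-length cy) ⟩
    q′ * N            ∎)
    where open ≡-Reasoning

  Conj-pow-injective : ∀ {x y} q → 0 < q → Conj z x → Conj z y → pow x q ≡ pow y q → x ≡ y
  Conj-pow-injective q 0<q cx cy = pow-injective q 0<q (trans (Conj-length cx) (sym (Conj-length cy)))

  module Squares (prim : Primitive z) (w : List A) (R : ℕ) (maxr : IsMax (SqExp w z) (suc R)) where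

    -- (x , j) stands for the square x^(2(j + 1)); the top exponent is 2(R + 1).
    Low : List A → Set
    Low = Image {B = List A × ℕ} (λ (x , j) → pow x (2 * suc j)) (λ (x , j) → Conj z x × j < R)

    Top : List A → Set
    Top = Image (λ x → pow x (2 * suc R)) (TopConj w z (suc R))

    Low⊎Top⇔SqW : ∀ u → (Low u ⊎ Top u) ⇔ SqW w z u
    Low⊎Top⇔SqW u = mk⇔ from to
      where
      from : Low u ⊎ Top u → SqW w z u
      from (inj₁ ((x , j) , (cx , j<R) , refl)) with proj₁ maxr
      ... | _ , x₀ , cx₀ , sq₀ = x , suc j , cx , s≤s z≤n , refl ,
        Factor-trans (Conj-pow-factor cx₀ cx (*-monoʳ-< 2 (s≤s j<R))) (SqW⇒Factor sq₀)
      from (inj₂ (x , (_ , sq) , refl)) = sq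
      to : SqW w z u → Low u ⊎ Top u
      to sq@(x , suc j , cx , 1≤i , refl , _)
        with m≤n⇒m<n∨m≡n (s≤s⁻¹ (proj₂ maxr (suc j) (1≤i , x , cx , sq)))
      ... | inj₁ j<R = inj₁ ((x , j) , (cx , j<R) , refl)
      ... | inj₂ refl = inj₂ (x , (cx , sq) , refl)

    Card-SqW : ∀ {s} → Card (TopConj w z (suc R)) s → Card (SqW w z) (N * R + s)
    Card-SqW cardTop = Card-cong Low⊎Top⇔SqW
      (Card-⊎ Low∩Top=∅ (Card-image low-injective (Card-× (Card-Conj prim) Card-upTo))
                        (Card-image (λ (cx , _) (cy , _) → Conj-pow-injective (2 * suc R) z<s cx cy) cardTop))
      where
      low-injective : ∀ {x y j k} → Conj z x × j < R → Conj z y × k < R →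
                      pow x (2 * suc j) ≡ pow y (2 * suc k) → (x , j) ≡ (y , k)
      low-injective {j = j} {k} (cx , _) (cy , _) eq
        with suc-injective (*-cancelˡ-≡ (suc j) (suc k) 2 (Conj-pow-exponent (2 * suc j) (2 * suc k) cx cy eq))
      ... | refl = cong (_, j) (Conj-pow-injective (2 * suc j) z<s cx cy eq)
      Low∩Top=∅ : ∀ {u} → Low u → Top u → ⊥
      Low∩Top=∅ ((x , j) , (cx , j<R) , refl) (y , (cy , _) , eq) =
        <⇒≢ j<R (suc-injective (*-cancelˡ-≡ (suc j) (suc R) 2 (Conj-pow-exponent (2 * suc j) (2 * suc R) cx cy eq)))

  module Circuits (_≟_ : DecidableEquality A) (prim : Primitive z) (w : List A) (R s : ℕ)
                  (maxr : IsMax (SqExp w z) (suc R)) (cardTop : Card (TopConj w z (suc R)) s) where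

    CS⇔windows : ∀ m → CS w z m ⇔ (N ≤ m × (∀ {k} → k < N → Factor (window letter k m) w))
    CS⇔windows m = mk⇔
      (λ (N≤m , ⊑w) → N≤m , λ {k} _ → subst (λ t → Factor t w) (fracPow-rot k m) (⊑w (rot k) (rot-Conj k)))
      (λ (N≤m , ⊑w) → N≤m , λ x cx → let k , k<N , x≡rotᵏ = Conj⇒rot cx in
        subst (λ t → Factor (fracPow t m) w) (sym x≡rotᵏ) (subst (λ t → Factor t w) (sym (fracPow-rot k m)) (⊑w k<N)))

    CS? : Decidable (CS w z)
    CS? m = map′ (Equivalence.from (CS⇔windows m)) (Equivalence.to (CS⇔windows m))
      ((N ≤? m) ×-dec allUpTo? (λ k → Factor? _≟_ (window letter k m) w) N)

    CS⇒≤ : ∀ {m} → CS w z m → m < suc (length w)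
    CS⇒≤ {m} cs = s≤s (subst (_≤ length w) (length-window letter 0 m)
                           (Factor-length (proj₂ (Equivalence.to (CS⇔windows m) cs) {0} z<s)))

    s≤N : s ≤ N
    s≤N = Card-mono cardTop (Card-Conj prim) proj₁

    0<s : 0 < s
    0<s with proj₁ maxr
    ... | _ , _ , cx₀ , sq₀ = Card⇒length≤ cardTop ([] ∷ []) ((cx₀ , sq₀) ∷ [])

    arc : ℕ → List (List A)
    arc p = applyUpTo (λ e → rot (p + s + e)) (suc (N ∸ s))

    arc-unique : ∀ p → Unique (arc p)
    arc-unique p = Unique.applyUpTo⁺₁ _ _ λ {i} {j} i<j j≤N∸s → rot-distinct prim (+-monoʳ-< (p + s) i<j)
      (<-≤-trans (+-monoʳ-< (p + s) (<-≤-trans j≤N∸s (∸-monoʳ-< 0<s s≤N))) (+-monoˡ-≤ N (m≤m+n (p + s) i)))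

    N<s+|arc| : ∀ p → N < s + length (arc p)
    N<s+|arc| p = subst (N <_) (sym (begin
      s + length (arc p)  ≡⟨ cong (s +_) (length-applyUpTo (λ e → rot (p + s + e)) (suc (N ∸ s))) ⟩
      s + suc (N ∸ s)     ≡⟨ +-suc s (N ∸ s) ⟩
      suc (s + (N ∸ s))   ≡⟨ cong suc (m+[n∸m]≡n s≤N) ⟩
      suc N               ∎)) (n<1+n N)
      where open ≡-Reasoning

    -- Pigeonhole: the arc holds N ∸ s + 1 distinct conjugates, and only N ∸ s are not top.
    top-meets-arc : ∀ p → ∃[ x ] (x ∈ arc p × TopConj w z (suc R) x)
    top-meets-arc p = Card-meets (≡-dec _≟_) (Card-Conj prim) cardTop proj₁ (arc-unique p)
      (All.applyUpTo⁺₂ (λ e → rot (p + s + e)) (suc (N ∸ s)) (λ e → rot-Conj (p + s + e))) (N<s+|arc| p)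

    top-in-arc : ∀ p → ∃[ e ] (e ≤ N ∸ s × TopConj w z (suc R) (rot (p + s + e)))
    top-in-arc p =
      let x , x∈arc , top = top-meets-arc p
          e , e<1+N∸s , x≡rot = ∈-applyUpTo⁻ (λ e → rot (p + s + e)) x∈arc
      in e , s≤s⁻¹ e<1+N∸s , subst (TopConj w z (suc R)) x≡rot top

    CS-N+t : ∀ {t} → t ≤ 2 * N * R + s → CS w z (N + t)
    CS-N+t {t} t≤ = Equivalence.from (CS⇔windows (N + t)) (m≤m+n N t , window⊑w)
      where
      window⊑w : ∀ {p} → p < N → Factor (window letter p (N + t)) w
      window⊑w {p} _ = subst (λ u → Factor u w) (window-shift letter-periodic p (N + t))
        (Factor-trans (window-factor letter start≤p+N fits)
                      (subst (λ u → Factor u w) (pow-rot (p + s + e) (2 * suc R)) (SqW⇒Factor (proj₂ top))))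
        where
        e : ℕ
        e = proj₁ (top-in-arc p)
        e≤N∸s : e ≤ N ∸ s
        e≤N∸s = proj₁ (proj₂ (top-in-arc p))
        top : TopConj w z (suc R) (rot (p + s + e))
        top = proj₂ (proj₂ (top-in-arc p))
        start≤p+N : p + s + e ≤ p + N
        start≤p+N = begin
          p + s + e         ≡⟨ +-assoc p s e ⟩
          p + (s + e)       ≤⟨ +-monoʳ-≤ p (+-monoʳ-≤ s e≤N∸s) ⟩
          p + (s + (N ∸ s)) ≡⟨ cong (p +_) (m+[n∸m]≡n s≤N) ⟩
          p + N             ∎
          where open ≤-Reasoning
        fits : p + N + (N + t) ≤ p + s + e + 2 * suc R * N
        fits = begin
          p + N + (N + t)               ≤⟨ +-monoʳ-≤ (p + N) (+-monoʳ-≤ N t≤) ⟩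
          p + N + (N + (2 * N * R + s)) ≡⟨ m+n+[n+[2nr+s]]≡m+s+2[1+r]n p N R s ⟩
          p + s + 2 * suc R * N         ≤⟨ +-monoˡ-≤ (2 * suc R * N) (m≤m+n (p + s) e) ⟩
          p + s + e + 2 * suc R * N     ∎
          where
          open ≤-Reasoning
          m+n+[n+[2nr+s]]≡m+s+2[1+r]n : ∀ m n r s → m + n + (n + (2 * n * r + s)) ≡ m + s + 2 * suc r * n
          m+n+[n+[2nr+s]]≡m+s+2[1+r]n = solve-∀

    CS-lower-bound : ∃[ c ] (Card (CS w z) c × 2 * N * R + s + 1 ≤ c)
    CS-lower-bound with Card-bounded CS? CS⇒≤
    ... | c , cardCS = c , cardCS , subst (_≤ c) (trans (length-applyUpTo (N +_) L) (+-comm 1 (2 * N * R + s)))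
      (Card⇒length≤ cardCS (Unique.applyUpTo⁺₁ (N +_) L (λ i<j _ → <⇒≢ (+-monoʳ-< N i<j)))
                           (All.applyUpTo⁺₁ (N +_) L (λ t<L → CS-N+t (s≤s⁻¹ t<L))))
      where
      L : ℕ
      L = suc (2 * N * R + s)

lemma7 : (A : Set) (_<_ : Rel A 0ℓ) → IsStrictTotalOrder _≡_ _<_ →
    (w z : List A) → LynFactor _<_ w z →
    (n : ℕ) → Card {List A} (SqW w z) n → 1 ≤ n →
    (r : ℕ) → IsMax (SqExp w z) r →
    (s : ℕ) → Card {List A} (TopConj w z r) s →
    (n ≡ length z * (r ∸ 1) + s)
      × (∃[ c ] (Card (CS w z) c × 2 * length z * (r ∸ 1) + s + 1 ≤ c))
lemma7 _ _ _ _ [] ((prim , _) , _) _ _ _ _ _ _ _ = ⊥-elim (proj₁ prim refl)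
lemma7 _ _ _ _ (_ ∷ _) _ _ _ _ zero ((() , _) , _) _ _
lemma7 _ _ sto w (a ∷ z′) ((prim , _) , _) _ cardSq _ (suc R) maxr s cardTop =
  Card-unique cardSq (Squares.Card-SqW prim w R maxr cardTop) ,
  Circuits.CS-lower-bound (IsStrictTotalOrder._≟_ sto) prim w R s maxr cardTop
  where open Conjugates a z′
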